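{- Let $n\ge1$, $k\ge2$. For every play $(s_t)_{t=0}^m$ of the $(n,k)$-shift-game in which Bob uses strategy $B$ and Alice uses strategy $A$, let $b=|\{s_t : 0\le t\le m,\ B(s_t)=1\}|$ and $a=|\{s_t : 0\le t\le m,\ B(s_t)=0 \text{ and } A(s_t)=1\}|$. Then $b\le (n+a)(k-1)$.
   Context: $[k]=\{0,\dots,k-1\}$; words written by concatenation. A strategy for Bob is a function $B\colon[k]^n\to\{0,1\}$ with $B(x(k-1))=0$ for all $x\in[k]^{n-1}$; a strategy for Alice is a function $A\colon[k]^n\to\{0,1\}$ with $A(x0)=0$ for all $x\in[k]^{n-1}$. The $(n,k)$-shift-game: a play is a sequence $s_0,\dots,s_m$ with $s_0=0^n$ and, if $s_t=x\sigma$ ($x\in[k]^{n-1}$, $\sigma\in[k]$), then $s_{t+1}=(\sigma+1)x$ if $B(s_t)=1$; $s_{t+1}=0x$ if $B(s_t)=0$ and $A(s_t)=1$; and $s_{t+1}=\sigma x$ otherwise. The play ends at the first $m>0$ with $s_m\in\{s_0,\dots,s_{m-1}\}$. Alice wins if $m<k^n$ and $s_m=0^n$; Bob wins if $s_m\ne0^n$; it is a tie if $m=k^n$ and $s_m=0^n$. -}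

module Defs where

open import Data.Nat using (ℕ; zero; suc; _<_)
open import Data.Fin using (Fin; zero; suc; fromℕ)
open import Data.Fin.Properties using (_≟_)
open import Data.Bool using (Bool; true; false; if_then_else_; not; _∧_)
open import Data.Vec using (Vec; _∷_; _∷ʳ_; init; last; replicate)
open import Data.Vec.Properties using (≡-dec)
open import Data.List using (List; upTo; map; length; filterᵇ; deduplicate)
open import Data.Product using (Σ; _×_)
open import Relation.Binary.PropositionalEquality using (_≡_)
open import Relation.Nullary using (¬_)

-- Alphabet [k] = Fin k; words of length n are Vec (Fin k) n.
-- A word "x σ" has last letter σ = last w and prefix x = init w.

incr : ∀ {m} → Fin (suc m) → Fin (suc m)
incr {zero}  zero    = zero
incr {suc m} zero    = suc zero
incr {suc m} (suc i) = suc (incr {m} i)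

-- Word over [k] of length n, where k = suc K and n = suc N
Word : ℕ → ℕ → Set
Word K N = Vec (Fin (suc K)) (suc N)

IsBobStrategy : (K N : ℕ) → (Word K N → Bool) → Set
IsBobStrategy K N B = ∀ (x : Vec (Fin (suc K)) N) → B (x ∷ʳ fromℕ K) ≡ false

IsAliceStrategy : (K N : ℕ) → (Word K N → Bool) → Set
IsAliceStrategy K N A = ∀ (x : Vec (Fin (suc K)) N) → A (x ∷ʳ zero) ≡ false

step : ∀ {K N} → (B A : Word K N → Bool) → Word K N → Word K N
step B A w =
  if B w then incr (last w) ∷ init w
  else (if A w then zero ∷ init w else last w ∷ init w)

play : ∀ {K N} → (B A : Word K N → Bool) → ℕ → Word K N
play B A zero    = replicate _ zero
play B A (suc t) = step B A (play B A t)

Repeats : ∀ {K N} → (B A : Word K N → Bool) → ℕ → Set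
Repeats B A m = Σ ℕ (λ t → t < m × play B A t ≡ play B A m)

IsEnd : ∀ {K N} → (B A : Word K N → Bool) → ℕ → Set
IsEnd B A m = (0 < m) × Repeats B A m × (∀ m' → 0 < m' → m' < m → ¬ Repeats B A m')

visited : ∀ {K N} → (B A : Word K N → Bool) → ℕ → List (Word K N)
visited B A m = deduplicate (≡-dec _≟_) (map (play B A) (upTo (suc m)))

bCount : ∀ {K N} → (B A : Word K N → Bool) → ℕ → ℕ
bCount B A m = length (filterᵇ B (visited B A m))

aCount : ∀ {K N} → (B A : Word K N → Bool) → ℕ → ℕ
aCount B A m = length (filterᵇ (λ w → not (B w) ∧ A w) (visited B A m))

-- The digit sum of the current word is a potential: a Bob move raises it by exactly 1
-- (his letter is never k − 1, so incrementing it does not wrap around), an Alice move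
-- lowers it by the reset letter, i.e. by at most k − 1, and a pass only rotates the word.
-- Hence along s₀, …, s_m the number of Bob moves is at most the final digit sum plus
-- (k − 1) times the number of Alice moves, and the final digit sum is at most n(k − 1).
-- Since s₀, …, s_{m−1} are distinct and s_m repeats one of them, these move counts are the
-- cardinalities b and a of the statement.
module Submission where

open import Defs
open import Data.Nat using (ℕ; suc; _+_; _*_; _∸_; _≤_)
open import Data.Bool using (Bool)

open import Data.Nat using (zero; _<_; z≤n; s≤s)
open import Data.Nat.Properties
  using (+-comm; +-assoc; +-identityʳ; *-comm; *-suc; *-distribʳ-+; ≤-trans; n≤1+n;
         +-mono-≤; +-monoˡ-≤; *-monoʳ-≤; module ≤-Reasoning)
open import Data.Fin using (Fin; toℕ; fromℕ)
open import Data.Fin.Properties using (_≟_; toℕ≤pred[n])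
open import Data.Bool using (true; false; if_then_else_; not; _∧_)
open import Data.Vec using (Vec; []; _∷_; _∷ʳ_; init; last; initLast)
open import Data.Vec.Properties using (≡-dec)
open import Data.List using (List; []; _∷_; length; map; applyUpTo; upTo; deduplicate; filterᵇ; _++_; [_])
open import Data.List.Properties using (length-++; length-++-sucʳ; filter-++; applyUpTo-∷ʳ; map-applyUpTo)
open import Data.List.Membership.Propositional using (_∈_)
open import Data.List.Membership.Propositional.Properties
  using (∈-∃++; ∈-++⁻; ∈-++⁺ˡ; ∈-++⁺ʳ; ∈-applyUpTo⁺; ∈-deduplicate⁻; ∈-deduplicate⁺)
open import Data.List.Relation.Unary.Any using (here; there)
import Data.List.Relation.Unary.All as All
open import Data.List.Relation.Unary.AllPairs using (_∷_)
open import Data.List.Relation.Unary.AllPairs.Properties using (applyUpTo⁺₁)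
open import Data.List.Relation.Unary.Unique.Propositional using (Unique)
open import Data.List.Relation.Unary.Unique.Propositional.Properties using (filter⁺)
open import Data.List.Relation.Unary.Unique.DecPropositional.Properties using (deduplicate-!)
open import Data.List.Relation.Binary.Subset.Propositional using (_⊆_)
open import Data.List.Relation.Binary.Subset.Propositional.Properties using (filter⁺′; applyUpTo⁺)
open import Data.Product using (_,_; proj₂)
open import Data.Sum using (inj₁; inj₂)
open import Function using (id; _∘_)
open import Relation.Nullary using (¬_; contradiction)
open import Relation.Nullary.Decidable using (T?)
open import Relation.Binary.PropositionalEquality
  using (_≡_; _≢_; refl; sym; trans; cong; subst; ≢-sym; module ≡-Reasoning)

∈-++-∷⇒∈-++ : ∀ {A : Set} {x y : A} ys zs → y ∈ ys ++ x ∷ zs → y ≢ x → y ∈ ys ++ zs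
∈-++-∷⇒∈-++ ys zs y∈ y≢x with ∈-++⁻ ys y∈
... | inj₁ y∈ys         = ∈-++⁺ˡ y∈ys
... | inj₂ (here y≡x)   = contradiction y≡x y≢x
... | inj₂ (there y∈zs) = ∈-++⁺ʳ ys y∈zs

Unique-⊆⇒length≤ : ∀ {A : Set} {xs ys : List A} → Unique xs → xs ⊆ ys → length xs ≤ length ys
Unique-⊆⇒length≤ {xs = []}     _           _     = z≤n
Unique-⊆⇒length≤ {xs = x ∷ xs} (x∉xs ∷ u) xs⊆ys with ∈-∃++ (xs⊆ys (here refl))
... | ys₁ , ys₂ , refl = subst (suc (length xs) ≤_) (sym (length-++-sucʳ ys₁ x ys₂))
  (s≤s (Unique-⊆⇒length≤ u λ y∈xs →
    ∈-++-∷⇒∈-++ ys₁ ys₂ (xs⊆ys (there y∈xs)) (≢-sym (All.lookup x∉xs y∈xs))))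

length-filterᵇ-mono : ∀ {A : Set} (p : A → Bool) {xs ys : List A} →
  Unique xs → xs ⊆ ys → length (filterᵇ p xs) ≤ length (filterᵇ p ys)
length-filterᵇ-mono p u xs⊆ys =
  Unique-⊆⇒length≤ (filter⁺ (T? ∘ p) u) (filter⁺′ (T? ∘ p) (T? ∘ p) id xs⊆ys)

length-filterᵇ-∷ʳ : ∀ {A : Set} (p : A → Bool) xs x →
  length (filterᵇ p (xs ++ [ x ])) ≡ length (filterᵇ p xs) + (if p x then 1 else 0)
length-filterᵇ-∷ʳ p xs x rewrite filter-++ (T? ∘ p) xs [ x ] | length-++ (filterᵇ p xs) {filterᵇ p [ x ]}
  with p x
... | true  = refl
... | false = refl

toℕ-incr : ∀ {m} (σ : Fin (suc m)) → σ ≢ fromℕ m → toℕ (incr σ) ≡ suc (toℕ σ)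
toℕ-incr {zero}  Fin.zero    σ≢max = contradiction refl σ≢max
toℕ-incr {suc m} Fin.zero    σ≢max = refl
toℕ-incr {suc m} (Fin.suc σ) σ≢max = cong suc (toℕ-incr σ (σ≢max ∘ cong Fin.suc))

xs≡init∷ʳlast : ∀ {A : Set} {n} (xs : Vec A (suc n)) → xs ≡ init xs ∷ʳ last xs
xs≡init∷ʳlast xs = proj₂ (proj₂ (initLast xs))

digitSum : ∀ {k n} → Vec (Fin k) n → ℕ
digitSum []       = 0
digitSum (σ ∷ xs) = toℕ σ + digitSum xs

digitSum≤ : ∀ {K n} (xs : Vec (Fin (suc K)) n) → digitSum xs ≤ n * K
digitSum≤ []       = z≤n
digitSum≤ (σ ∷ xs) = +-mono-≤ (toℕ≤pred[n] σ) (digitSum≤ xs)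

digitSum-∷ʳ : ∀ {k n} (xs : Vec (Fin k) n) σ → digitSum (xs ∷ʳ σ) ≡ digitSum xs + toℕ σ
digitSum-∷ʳ []       σ = +-comm (toℕ σ) 0
digitSum-∷ʳ (τ ∷ xs) σ = trans (cong (toℕ τ +_) (digitSum-∷ʳ xs σ)) (sym (+-assoc (toℕ τ) _ _))

digitSum-rotate : ∀ {k n} (w : Vec (Fin k) (suc n)) → digitSum (last w ∷ init w) ≡ digitSum w
digitSum-rotate w = begin
  toℕ (last w) + digitSum (init w) ≡⟨ +-comm (toℕ (last w)) _ ⟩
  digitSum (init w) + toℕ (last w) ≡⟨ digitSum-∷ʳ (init w) (last w) ⟨
  digitSum (init w ∷ʳ last w)      ≡⟨ cong digitSum (xs≡init∷ʳlast w) ⟨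
  digitSum w                       ∎
  where open ≡-Reasoning

digitSum-incr-rotate : ∀ {K n} (w : Vec (Fin (suc K)) (suc n)) → last w ≢ fromℕ K →
  digitSum (incr (last w) ∷ init w) ≡ suc (digitSum w)
digitSum-incr-rotate w last≢max =
  trans (cong (_+ digitSum (init w)) (toℕ-incr (last w) last≢max)) (cong suc (digitSum-rotate w))

digitSum-reset-rotate : ∀ {K n} (w : Vec (Fin (suc K)) (suc n)) →
  digitSum w ≤ digitSum (Fin.zero ∷ init w) + K
digitSum-reset-rotate {K} w = begin
  digitSum w                       ≡⟨ digitSum-rotate w ⟨
  toℕ (last w) + digitSum (init w) ≤⟨ +-monoˡ-≤ _ (toℕ≤pred[n] (last w)) ⟩
  K + digitSum (init w)            ≡⟨ +-comm K _ ⟩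
  digitSum (init w) + K            ∎
  where open ≤-Reasoning

RepeatFreeBefore : ∀ {K N} → (B A : Word K N → Bool) → ℕ → Set
RepeatFreeBefore B A m = ∀ m′ → 0 < m′ → m′ < m → ¬ Repeats B A m′

module _ {K N : ℕ} (B A : Word K N → Bool) where

  aliceMoves : Word K N → Bool
  aliceMoves w = not (B w) ∧ A w

  played : ℕ → List (Word K N)
  played = applyUpTo (play B A)

  moves : (Word K N → Bool) → ℕ → ℕ
  moves p T = length (filterᵇ p (played T))

  moves-suc : ∀ p T → moves p (suc T) ≡ moves p T + (if p (play B A T) then 1 else 0)
  moves-suc p T = trans (cong (length ∘ filterᵇ p) (sym (applyUpTo-∷ʳ (play B A) T)))
                        (length-filterᵇ-∷ʳ p (played T) (play B A T))

  bobLetter≢max : IsBobStrategy K N B → ∀ w → B w ≡ true → last w ≢ fromℕ K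
  bobLetter≢max bob w Bw last≡max with trans (sym Bw) (trans (cong B (xs≡init∷ʳlast w))
    (trans (cong (λ σ → B (init w ∷ʳ σ)) last≡max) (bob (init w))))
  ... | ()

  potential-step : IsBobStrategy K N B → ∀ w {b a} → b ≤ digitSum w + K * a →
    b + (if B w then 1 else 0) ≤ digitSum (step B A w) + K * (a + (if aliceMoves w then 1 else 0))
  potential-step bob w {b} {a} b≤ with B w in Bw | A w
  ... | true | _ = begin
    b + 1                                         ≡⟨ +-comm b 1 ⟩
    suc b                                         ≤⟨ s≤s b≤ ⟩
    suc (digitSum w) + K * a                      ≡⟨ cong (_+ K * a) (digitSum-incr-rotate w (bobLetter≢max bob w Bw)) ⟨
    digitSum (incr (last w) ∷ init w) + K * a     ≡⟨ cong (λ a → _ + K * a) (+-identityʳ a) ⟨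
    digitSum (incr (last w) ∷ init w) + K * (a + 0) ∎
    where open ≤-Reasoning
  ... | false | true = begin
    b + 0                  ≡⟨ +-identityʳ b ⟩
    b                      ≤⟨ b≤ ⟩
    digitSum w + K * a     ≤⟨ +-monoˡ-≤ (K * a) (digitSum-reset-rotate w) ⟩
    reset + K + K * a      ≡⟨ +-assoc reset K (K * a) ⟩
    reset + (K + K * a)    ≡⟨ cong (reset +_) (*-suc K a) ⟨
    reset + K * suc a      ≡⟨ cong (λ a → reset + K * a) (+-comm 1 a) ⟩
    reset + K * (a + 1)    ∎
    where
      open ≤-Reasoning
      reset : ℕ
      reset = digitSum (Fin.zero ∷ init w)
  ... | false | false rewrite +-identityʳ b | +-identityʳ a | digitSum-rotate w = b≤

  bobMoves≤ : IsBobStrategy K N B → ∀ T → moves B T ≤ digitSum (play B A T) + K * moves aliceMoves T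
  bobMoves≤ bob zero    = z≤n
  bobMoves≤ bob (suc T) rewrite moves-suc B T | moves-suc aliceMoves T =
    potential-step bob (play B A T) (bobMoves≤ bob T)

  played-unique : ∀ {m} → RepeatFreeBefore B A m → Unique (played m)
  played-unique {m} noRepeat = applyUpTo⁺₁ (play B A) m λ i<j j<m si≡sj →
    noRepeat _ (≤-trans (s≤s z≤n) i<j) j<m (_ , i<j , si≡sj)

  played-suc⊆played : ∀ {m} → Repeats B A m → played (suc m) ⊆ played m
  played-suc⊆played {m} (t , t<m , st≡sm) {w} w∈
    with ∈-++⁻ (played m) (subst (w ∈_) (sym (applyUpTo-∷ʳ (play B A) m)) w∈)
  ... | inj₁ w∈played    = w∈played
  ... | inj₂ (here refl) = subst (_∈ played m) st≡sm (∈-applyUpTo⁺ (play B A) t<m)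

  visited≡ : ∀ m → visited B A m ≡ deduplicate (≡-dec _≟_) (played (suc m))
  visited≡ m = cong (deduplicate (≡-dec _≟_)) (map-applyUpTo id (play B A) (suc m))

  visited⊆played : ∀ {m} → Repeats B A m → visited B A m ⊆ played m
  visited⊆played {m} repeats {w} w∈ = played-suc⊆played repeats
    (∈-deduplicate⁻ (≡-dec _≟_) (played (suc m)) (subst (w ∈_) (visited≡ m) w∈))

  played⊆visited : ∀ {m} → played m ⊆ visited B A m
  played⊆visited {m} {w} w∈ = subst (w ∈_) (sym (visited≡ m))
    (∈-deduplicate⁺ (≡-dec _≟_) (applyUpTo⁺ (play B A) (n≤1+n m) w∈))

  bCount≤moves : ∀ {m} → Repeats B A m → bCount B A m ≤ moves B m
  bCount≤moves {m} repeats =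
    length-filterᵇ-mono B (deduplicate-! (≡-dec _≟_) (map (play B A) (upTo (suc m)))) (visited⊆played repeats)

  moves≤aCount : ∀ {m} → RepeatFreeBefore B A m → moves aliceMoves m ≤ aCount B A m
  moves≤aCount noRepeat = length-filterᵇ-mono aliceMoves (played-unique noRepeat) played⊆visited

proposition10 : (N K' : ℕ) → (B A : Word (suc K') N → Bool) →
    IsBobStrategy (suc K') N B → IsAliceStrategy (suc K') N A →
    (m : ℕ) → IsEnd B A m →
    bCount B A m ≤ (suc N + aCount B A m) * (suc (suc K') ∸ 1)
proposition10 N K' B A bob _ m (_ , repeats , noRepeat) = begin
  bCount B A m                                    ≤⟨ bCount≤moves B A repeats ⟩
  moves B A B m                                   ≤⟨ bobMoves≤ B A bob m ⟩
  digitSum (play B A m) + K * moves B A (aliceMoves B A) m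
    ≤⟨ +-mono-≤ (digitSum≤ (play B A m)) (*-monoʳ-≤ K (moves≤aCount B A noRepeat)) ⟩
  suc N * K + K * aCount B A m                    ≡⟨ cong (suc N * K +_) (*-comm K _) ⟩
  suc N * K + aCount B A m * K                    ≡⟨ *-distribʳ-+ K (suc N) _ ⟨
  (suc N + aCount B A m) * K                      ∎
  where
    open ≤-Reasoning
    K : ℕ
    K = suc K'
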